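{- For every $f:\{0,1\}^n\to\{0,1\}$ computable by a width-$d$ read-once branching program of length $n$, there is an integer $0\le k\le n$ and a function $g:\{0,1\}^{n-k}\to\{0,1\}$ computable by a width-$d$ read-once branching program with sudden death of length $n-k$, such that $\{0^k\circ y: g(y)=1\}\subseteq f^{ -1}(1)$ and $\mathbb{E}[g]\ge\mathbb{E}[f]^2/(2n)$.
   Context: A read-once branching program (ROBP) of width $d$ and length $n$ has vertex set partitioned into layers $V_0\cup\cdots\cup V_n$ with $V_0=\{(0,0)\}$ (start state), $V_t=\{(t,i)\}_{i\in[d]}$ for $1\le t\le n-1$, $V_n=\{(n,1),(n,d)\}$ ($(n,1)$ accepts, $(n,d)$ rejects). Each vertex of $V_t$ ($t<n$) has two out-edges labeled $0$ and $1$ into $V_{t+1}$. On input $x\in\{0,1\}^n$, start at $(0,0)$ and from layer $t$ follow the edge labeled $x_{t+1}$; $x$ is accepted iff the path ends at $(n,1)$. A width-$d$ ROBP with sudden death is one in which both out-edges of $(t,d)$ go to $(t+1,d)$ for all $t=1,\ldots,n-1$ (so the bottom-level states are all rejecting). $\mathbb{E}$ is under the uniform distribution. -}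

module Defs where

open import Data.Bool using (Bool; true; false; if_then_else_)
open import Data.Nat using (ℕ; zero; suc; _+_; _*_; _^_; NonZero)
open import Data.Nat.Properties using (m^n≢0; m*n≢0)
open import Data.Fin using (Fin; fromℕ)
open import Data.Vec using (Vec; []; _∷_)
open import Data.Product using (Σ; _×_; _,_)
open import Data.Unit using (⊤)
open import Data.Integer using (+_)
open import Data.Rational using (ℚ; _/_)
open import Relation.Binary.PropositionalEquality using (_≡_)

-- Bits: 0 = false, 1 = true.  Middle-layer states V_t = {(t,i)}_{i∈[d]} are
-- represented by Fin d (index i-1); the bottom state (t,d) is fromℕ d' when d = suc d'.
-- The final layer V_n = {(n,1),(n,d)} is represented by Bool (true = accept (n,1)).

-- Mid d m : the transitions of a width-d program from a middle layer
-- with m ≥ 1 remaining steps.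
Mid : ℕ → ℕ → Set
Mid d zero = ⊤
Mid d (suc zero) = Fin d → Bool → Bool
Mid d (suc (suc m)) = (Fin d → Bool → Fin d) × Mid d (suc m)

-- Length 1 : start state (0,0) goes directly to V_1 = V_n.
-- Length ≥ 2 : start edges into V_1 (Fin d), then the middle/final transitions.
ROBP : ℕ → ℕ → Set
ROBP d zero = Bool
ROBP d (suc zero) = Bool → Bool
ROBP d (suc (suc m)) = (Bool → Fin d) × Mid d (suc m)

runMid : ∀ {d} m → Mid d (suc m) → Fin d → Vec Bool (suc m) → Bool
runMid zero δ s (b ∷ []) = δ s b
runMid (suc m) (δ , rest) s (b ∷ xs) = runMid m rest (δ s b) xs

eval : ∀ {d} n → ROBP d n → Vec Bool n → Bool
eval zero c [] = c
eval (suc zero) δ (b ∷ []) = δ b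
eval (suc (suc m)) (δ₀ , rest) (b ∷ xs) = runMid m rest (δ₀ b) xs

-- Sudden death: both out-edges of the bottom state (t,d), 1 ≤ t ≤ n-1,
-- go to (t+1,d) (for t = n-1 this is the rejecting state (n,d)).
SDMid : ∀ d m → Mid d (suc m) → Set
SDMid zero m δ = ⊤
SDMid (suc d') zero δ = (b : Bool) → δ (fromℕ d') b ≡ false
SDMid (suc d') (suc m) (δ , rest) =
  ((b : Bool) → δ (fromℕ d') b ≡ fromℕ d') × SDMid (suc d') m rest

SuddenDeath : ∀ d n → ROBP d n → Set
SuddenDeath d zero P = ⊤
SuddenDeath d (suc zero) P = ⊤
SuddenDeath d (suc (suc m)) (δ₀ , rest) = SDMid d m rest

Computable : ∀ d n → (Vec Bool n → Bool) → Set
Computable d n f = Σ (ROBP d n) λ P → ∀ x → eval n P x ≡ f x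

ComputableSD : ∀ d n → (Vec Bool n → Bool) → Set
ComputableSD d n f = Σ (ROBP d n) λ P → SuddenDeath d n P × (∀ x → eval n P x ≡ f x)

count : ∀ n → (Vec Bool n → Bool) → ℕ
count zero f = if f [] then 1 else 0
count (suc n) f = count n (λ xs → f (false ∷ xs)) + count n (λ xs → f (true ∷ xs))

E : ∀ n → (Vec Bool n → Bool) → ℚ
E n f = (+ count n f) / (2 ^ n) where instance _ = m^n≢0 2 n

inv2n : ∀ n → .{{NonZero n}} → ℚ
inv2n n = (+ 1) / (2 * n) where instance _ = m*n≢0 2 n

module Submission where

-- The states reached from a state v by reading only zeros form its zero
-- path v = v₀, v₁, ….  With acc(u) the number of accepted continuations from u, put
--     peak(v) = max(acc(v), 2·peak(v₁)) = max_j 2^j · acc(v_j).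
-- Pruning: rejecting every input whose path enters the zero path of v loses at most
-- peak(v) accepted inputs, and swapping each v_j with the bottom state turns the pruned
-- program into one with sudden death.  Greedy choice: walk along the zero path of the
-- start state while peak(v_j)/(n - j) does not drop, then prune there.  This yields k and
-- a sudden-death g on n - k bits with g(y) = 1 ⇒ f(0^k·y) = 1 and
--     |f⁻¹(1)| ≤ peak(start) ≤ n · 2^k · |g⁻¹(1)|,
-- which with |f⁻¹(1)| ≤ 2^n gives E[f]²/(2n) ≤ E[g].

open import Data.Nat using (ℕ)

module Counting where

  open import Data.Bool using (Bool; true; false)
  open import Data.Nat using (zero; suc; _+_; _^_; _≤_; z≤n; s≤s)
  open import Data.Nat.Properties using (+-mono-≤; +-identityʳ)
  open import Data.Vec using (Vec; []; _∷_)
  open import Relation.Binary.PropositionalEquality using (_≡_; refl; cong₂; subst; sym)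
  open import Defs using (count)

  count-ext : ∀ n {f g : Vec Bool n → Bool} → (∀ x → f x ≡ g x) → count n f ≡ count n g
  count-ext zero h rewrite h [] = refl
  count-ext (suc n) h =
    cong₂ _+_ (count-ext n (λ x → h (false ∷ x))) (count-ext n (λ x → h (true ∷ x)))

  count≤2^n : ∀ n (f : Vec Bool n → Bool) → count n f ≤ 2 ^ n
  count≤2^n zero f with f []
  ... | true  = s≤s z≤n
  ... | false = z≤n
  count≤2^n (suc n) f =
    subst (count (suc n) f ≤_) (cong₂ _+_ refl (sym (+-identityʳ (2 ^ n))))
      (+-mono-≤ (count≤2^n n _) (count≤2^n n _))

module Arithmetic where

  open import Data.Nat
  open import Data.Nat.Properties
  open import Data.Nat.Tactic.RingSolver using (solve; solve-∀)
  open import Data.List using ([]; _∷_)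
  open import Data.Sum using (inj₁; inj₂)
  open import Data.Empty using (⊥-elim)
  open import Relation.Binary.PropositionalEquality using (_≡_; sym; subst)

  -- Two branches, each losing at most p, lose at most 2·p together.
  shifted-sum : ∀ a b p → (a + p) + (b + p) ≡ (a + b) + 2 * p
  shifted-sum = solve-∀

  -- Skip step of the greedy choice: if p/(r+2) ≤ 2·p₀/(r+1) and p₀ ≤ (r+1)·K·c,
  -- then p ≤ (r+2)·(2K)·c.
  skip-bound : ∀ r p p₀ K c → suc r * p ≤ suc (suc r) * (2 * p₀) →
               p₀ ≤ suc r * (K * c) → p ≤ suc (suc r) * ((2 * K) * c)
  skip-bound r p p₀ K c flat p₀-bound = *-cancelˡ-≤ (suc r) (begin
    suc r * p                               ≤⟨ flat ⟩
    suc (suc r) * (2 * p₀)                  ≤⟨ *-monoʳ-≤ (suc (suc r)) (*-monoʳ-≤ 2 p₀-bound) ⟩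
    suc (suc r) * (2 * (suc r * (K * c)))   ≡⟨ solve (r ∷ K ∷ c ∷ []) ⟩
    suc r * (suc (suc r) * ((2 * K) * c))   ∎)
    where open ≤-Reasoning

  -- Prune step of the greedy choice: if the tail term T is small against a ⊔ T,
  -- namely (r+1)·T < r·(a ⊔ T), and a ≤ c + T, then a ⊔ T ≤ (r+1)·c.
  prune-bound : ∀ r a T c → suc r * T < r * (a ⊔ T) → a ≤ c + T → a ⊔ T ≤ suc r * c
  prune-bound r a T c steep a≤c+T with ⊔-sel a T
  ... | inj₂ a⊔T≡T =
    ⊥-elim (<⇒≱ (subst (λ u → suc r * T < r * u) a⊔T≡T steep) (*-monoˡ-≤ T (n≤1+n r)))
  ... | inj₁ a⊔T≡a =
    subst (_≤ suc r * c) (sym a⊔T≡a) (<⇒≤ (+-cancelʳ-< (r * a) a (suc r * c) (begin-strict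
      a + r * a               ≡⟨⟩
      suc r * a               ≤⟨ *-monoʳ-≤ (suc r) a≤c+T ⟩
      suc r * (c + T)         ≡⟨ *-distribˡ-+ (suc r) c T ⟩
      suc r * c + suc r * T   <⟨ +-monoʳ-< (suc r * c) T-small ⟩
      suc r * c + r * a       ∎)))
    where
    open ≤-Reasoning
    T-small : suc r * T < r * a
    T-small = subst (λ u → suc r * T < r * u) a⊔T≡a steep

  scaled-bound : ∀ n c g K M → c ≤ n * (K * g) → c * M ≤ n * g * (K * M)
  scaled-bound n c g K M c-bound = begin
    c * M               ≤⟨ *-monoˡ-≤ M c-bound ⟩
    n * (K * g) * M     ≡⟨ solve (n ∷ K ∷ g ∷ M ∷ []) ⟩
    n * g * (K * M)     ∎
    where open ≤-Reasoning

  -- From c ≤ P and c·M ≤ n·g·P: c²·M ≤ g·P²·(2n), the cleared-denominator form of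
  -- (c/P)² / (2n) ≤ g/M.
  square-bound : ∀ n c g P M → c ≤ P → c * M ≤ n * g * P →
                 c * c * 1 * M ≤ g * (P * P * (2 * n))
  square-bound n c g P M c≤P cM-bound = begin
    c * c * 1 * M           ≡⟨ solve (c ∷ M ∷ []) ⟩
    c * (c * M)             ≤⟨ *-mono-≤ c≤P cM-bound ⟩
    P * (n * g * P)         ≡⟨ solve (n ∷ g ∷ P ∷ []) ⟩
    g * (P * P * n)         ≤⟨ *-monoʳ-≤ g (*-monoʳ-≤ (P * P) (m≤n*m n 2)) ⟩
    g * (P * P * (2 * n))   ∎
    where open ≤-Reasoning

module Fractions where

  import Data.Nat as ℕ
  open import Data.Nat using (suc; NonZero)
  open import Data.Nat.Properties using (m*n≢0; m^n≢0; ^-distribˡ-+-*)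
  import Data.Integer as ℤ
  open import Data.Integer using (+_; +≤+)
  open import Data.Integer.Properties using (pos-*)
  open import Data.Rational using (ℚ; toℚᵘ; _/_; _*_; _≤_)
  open import Data.Rational.Properties
    using (toℚᵘ-fromℚᵘ; toℚᵘ-injective; toℚᵘ-cancel-≤; toℚᵘ-homo-*; module ≤-Reasoning)
  open import Data.Rational.Unnormalised using (mkℚᵘ; *≤*; *≡*)
    renaming (_/_ to _/ᵘ_; _≃_ to _≃ᵘ_; _*_ to _*ᵘ_)
  open import Data.Rational.Unnormalised.Properties as ℚᵘ
    using (≃-sym; *-cong; ≤-respˡ-≃; ≤-respʳ-≃)
  open import Relation.Binary.PropositionalEquality
    using (_≡_; refl; cong; sym; subst; subst₂)
  open import Defs using (inv2n)
  open Arithmetic using (scaled-bound; square-bound)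

  toℚᵘ-/ : ∀ a A .{{_ : NonZero A}} → toℚᵘ (+ a / A) ≃ᵘ (+ a /ᵘ A)
  toℚᵘ-/ a (suc A) = toℚᵘ-fromℚᵘ (mkℚᵘ (+ a) A)

  /ᵘ-* : ∀ a A b B .{{_ : NonZero A}} .{{_ : NonZero B}} →
         (+ a /ᵘ A) *ᵘ (+ b /ᵘ B) ≃ᵘ _/ᵘ_ (+ (a ℕ.* b)) (A ℕ.* B) {{m*n≢0 A B}}
  /ᵘ-* a (suc A) b (suc B) =
    *≡* (cong (ℤ._* + suc (B ℕ.+ A ℕ.* suc B)) (sym (pos-* a b)))

  /-* : ∀ a A b B .{{_ : NonZero A}} .{{_ : NonZero B}} →
        (+ a / A) * (+ b / B) ≡ _/_ (+ (a ℕ.* b)) (A ℕ.* B) {{m*n≢0 A B}}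
  /-* a A b B = toℚᵘ-injective (begin-equality
    toℚᵘ ((+ a / A) * (+ b / B))       ≃⟨ toℚᵘ-homo-* (+ a / A) (+ b / B) ⟩
    toℚᵘ (+ a / A) *ᵘ toℚᵘ (+ b / B)   ≃⟨ *-cong (toℚᵘ-/ a A) (toℚᵘ-/ b B) ⟩
    (+ a /ᵘ A) *ᵘ (+ b /ᵘ B)           ≃⟨ /ᵘ-* a A b B ⟩
    + ab /ᵘ AB                         ≃⟨ ≃-sym (toℚᵘ-/ ab AB) ⟩
    toℚᵘ (+ ab / AB)                   ∎)
    where
    open ℚᵘ.≤-Reasoning
    ab AB : ℕ
    ab = a ℕ.* b
    AB = A ℕ.* B
    instance
      AB-nonZero : NonZero AB
      AB-nonZero = m*n≢0 A B

  /-mono-≤ : ∀ a A b B .{{_ : NonZero A}} .{{_ : NonZero B}} →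
             a ℕ.* B ℕ.≤ b ℕ.* A → (+ a / A) ≤ (+ b / B)
  /-mono-≤ a A@(suc _) b B@(suc _) cross = toℚᵘ-cancel-≤
    (≤-respʳ-≃ (≃-sym (toℚᵘ-/ b B)) (≤-respˡ-≃ (≃-sym (toℚᵘ-/ a A))
      (*≤* (subst₂ ℤ._≤_ (pos-* a B) (pos-* b A) (+≤+ cross)))))

  density : ℕ → ℕ → ℚ
  density c n = _/_ (+ c) (2 ℕ.^ n) {{m^n≢0 2 n}}

  density-bound : ∀ n k m c g .{{_ : NonZero n}} → k ℕ.+ m ≡ n →
                  c ℕ.≤ 2 ℕ.^ n → c ℕ.≤ n ℕ.* (2 ℕ.^ k ℕ.* g) →
                  (density c n * density c n) * inv2n n ≤ density g m
  density-bound n k m c g refl c≤P c-bound = begin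
    (density c n * density c n) * inv2n n          ≡⟨ cong (_* inv2n n) (/-* c P c P) ⟩
    (+ (c ℕ.* c) / (P ℕ.* P)) * (+ 1 / (2 ℕ.* n))  ≡⟨ /-* (c ℕ.* c) (P ℕ.* P) 1 (2 ℕ.* n) ⟩
    + (c ℕ.* c ℕ.* 1) / (P ℕ.* P ℕ.* (2 ℕ.* n))
      ≤⟨ /-mono-≤ (c ℕ.* c ℕ.* 1) (P ℕ.* P ℕ.* (2 ℕ.* n)) g M
                  (square-bound n c g P M c≤P cM-bound) ⟩
    density g m                                    ∎
    where
    open ≤-Reasoning
    P M : ℕ
    P = 2 ℕ.^ n
    M = 2 ℕ.^ m
    instance
      P-nonZero : NonZero P
      P-nonZero = m^n≢0 2 n
      M-nonZero : NonZero M
      M-nonZero = m^n≢0 2 m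
      2n-nonZero : NonZero (2 ℕ.* n)
      2n-nonZero = m*n≢0 2 n
      P²-nonZero : NonZero (P ℕ.* P)
      P²-nonZero = m*n≢0 P P
      P²2n-nonZero : NonZero (P ℕ.* P ℕ.* (2 ℕ.* n))
      P²2n-nonZero = m*n≢0 (P ℕ.* P) (2 ℕ.* n)
    cM-bound : c ℕ.* M ℕ.≤ n ℕ.* g ℕ.* P
    cM-bound = subst (λ Q → c ℕ.* M ℕ.≤ n ℕ.* g ℕ.* Q) (sym (^-distribˡ-+-* 2 k m))
                 (scaled-bound n c g (2 ℕ.^ k) M c-bound)

-- Pruning the zero path of a state out of a program of width d.
module Pruning {d : ℕ} where

  open import Data.Bool using (Bool; true; false)
  open import Data.Nat using (zero; suc; _+_; _*_; _≤_; _⊔_)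
  open import Data.Nat.Properties
    using (≤-refl; ≤-trans; ≤-reflexive; +-mono-≤; +-monoʳ-≤; m≤m+n; m≤n+m; m≤m⊔n; m≤n⊔m)
  open import Data.Fin using (Fin; _≟_)
  open import Data.Vec using (Vec; []; _∷_)
  open import Data.Product using (_,_)
  open import Data.Empty using (⊥-elim)
  open import Relation.Nullary using (yes; no; ¬_)
  open import Relation.Binary.PropositionalEquality using (_≡_; refl)
  open import Defs using (Mid; runMid; count)
  open Arithmetic using (shifted-sum)

  accepts : ∀ m → Mid d (suc m) → Fin d → ℕ
  accepts m P s = count (suc m) (runMid m P s)

  -- peak(v) = max_j 2^j · acc(v_j) along the zero path v = v₀, v₁, … of v.
  peak : ∀ m → Mid d (suc m) → Fin d → ℕ
  peak zero P v = accepts zero P v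
  peak (suc m) P@(δ , rest) v = accepts (suc m) P v ⊔ 2 * peak m rest (δ v false)

  accepts≤peak : ∀ m P v → accepts m P v ≤ peak m P v
  accepts≤peak zero P v = ≤-refl
  accepts≤peak (suc m) P v = m≤m⊔n _ _

  -- runAvoiding m P x v: run P from x, rejecting as soon as the current state lies on
  -- the zero path of v (the current layer included).  stepAvoiding reads the first bit
  -- without that check.
  runAvoiding  : ∀ m → Mid d (suc m) → (x v : Fin d) → Vec Bool (suc m) → Bool
  stepAvoiding : ∀ m → Mid d (suc m) → (x v : Fin d) → Vec Bool (suc m) → Bool
  runAvoiding m P x v with x ≟ v
  ... | yes _ = λ _ → false
  ... | no _  = stepAvoiding m P x v
  stepAvoiding zero δ x v (b ∷ []) = δ x b
  stepAvoiding (suc m) (δ , rest) x v (b ∷ xs) = runAvoiding m rest (δ x b) (δ v false) xs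

  runAvoiding-on-path : ∀ m P x v → x ≡ v → ∀ xs → runAvoiding m P x v xs ≡ false
  runAvoiding-on-path m P x v x≡v xs with x ≟ v
  ... | yes _ = refl
  ... | no x≢v = ⊥-elim (x≢v x≡v)

  runAvoiding-off-path : ∀ m P x v → ¬ x ≡ v → ∀ xs →
                         runAvoiding m P x v xs ≡ stepAvoiding m P x v xs
  runAvoiding-off-path m P x v x≢v xs with x ≟ v
  ... | yes x≡v = ⊥-elim (x≢v x≡v)
  ... | no _ = refl

  runAvoiding-sound  : ∀ m P x v xs → runAvoiding m P x v xs ≡ true → runMid m P x xs ≡ true
  stepAvoiding-sound : ∀ m P x v xs → stepAvoiding m P x v xs ≡ true → runMid m P x xs ≡ true
  runAvoiding-sound m P x v xs accepted with x ≟ v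
  runAvoiding-sound m P x v xs () | yes _
  ... | no _ = stepAvoiding-sound m P x v xs accepted
  stepAvoiding-sound zero δ x v (b ∷ []) accepted = accepted
  stepAvoiding-sound (suc m) (δ , rest) x v (b ∷ xs) accepted =
    runAvoiding-sound m rest (δ x b) (δ v false) xs accepted

  runAvoiding-loss  : ∀ m P x v →
    accepts m P x ≤ count (suc m) (runAvoiding m P x v) + peak m P v
  stepAvoiding-loss : ∀ m δ rest x v →
    accepts (suc m) (δ , rest) x ≤ count (suc (suc m)) (stepAvoiding (suc m) (δ , rest) x v)
                                     + 2 * peak m rest (δ v false)
  runAvoiding-loss m P x v with x ≟ v
  runAvoiding-loss m P x v | yes refl = ≤-trans (accepts≤peak m P x) (m≤n+m _ _)
  runAvoiding-loss zero P x v | no _ = m≤m+n _ _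
  runAvoiding-loss (suc m) P@(δ , rest) x v | no _ =
    ≤-trans (stepAvoiding-loss m δ rest x v)
            (+-monoʳ-≤ (count (suc (suc m)) (stepAvoiding (suc m) P x v))
                       (m≤n⊔m (accepts (suc m) P v) (2 * peak m rest (δ v false))))
  stepAvoiding-loss m δ rest x v =
    ≤-trans (+-mono-≤ (runAvoiding-loss m rest (δ x false) v₁)
                      (runAvoiding-loss m rest (δ x true) v₁))
            (≤-reflexive (shifted-sum (kept false) (kept true) (peak m rest v₁)))
    where
    v₁ : Fin d
    v₁ = δ v false
    kept : Bool → ℕ
    kept b = count (suc m) (runAvoiding m rest (δ x b) v₁)

-- Turning a pruned program into a sudden-death program of width suc d′: at every
-- layer the zero-path state is swapped with the bottom state, which becomes a sink.
module SuddenDeathForm (d′ : ℕ) where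

  open import Data.Bool using (Bool; false; if_then_else_)
  open import Data.Nat using (zero; suc)
  open import Data.Fin using (Fin; fromℕ; _≟_)
  open import Data.Fin.Permutation.Components using (transpose; transpose-inverse)
  open import Data.Vec using ([]; _∷_)
  open import Data.Product using (_,_)
  open import Relation.Nullary using (Dec; does; yes; no; ¬_)
  open import Relation.Nullary.Decidable using (dec-true; dec-false)
  open import Relation.Binary.PropositionalEquality
    using (_≡_; refl; sym; trans; cong; module ≡-Reasoning)
  open import Defs using (Mid; runMid; SDMid; eval; ComputableSD)
  open Pruning {suc d′}

  dead : Fin (suc d′)
  dead = fromℕ d′

  transpose-sends : ∀ {n} (i j : Fin n) → transpose i j i ≡ j
  transpose-sends i j rewrite dec-true (i ≟ i) refl = refl

  -- rename v: old state ↦ new state, swapping v and dead; unrename v is its inverse.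
  rename unrename : Fin (suc d′) → Fin (suc d′) → Fin (suc d′)
  rename v = transpose v dead
  unrename v = transpose dead v

  unrename-rename : ∀ v x → unrename v (rename v x) ≡ x
  unrename-rename v x = transpose-inverse dead v

  unrename-dead : ∀ v → unrename v dead ≡ v
  unrename-dead v = transpose-sends dead v

  -- The new state dead stands for the old state v, which the pruned program rejects.
  on-dead : ∀ m P v xs → runAvoiding m P (unrename v dead) v xs ≡ false
  on-dead m P v = runAvoiding-on-path m P (unrename v dead) v (unrename-dead v)

  onPath : {A : Set} → Fin (suc d′) → Fin (suc d′) → A → A → A
  onPath v z a b = if does (unrename v z ≟ v) then a else b

  onPath-path : ∀ {A : Set} v z (a b : A) → unrename v z ≡ v → onPath v z a b ≡ a
  onPath-path v z a b on-path rewrite dec-true (unrename v z ≟ v) on-path = refl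

  onPath-off : ∀ {A : Set} v z (a b : A) → ¬ unrename v z ≡ v → onPath v z a b ≡ b
  onPath-off v z a b off-path rewrite dec-false (unrename v z ≟ v) off-path = refl

  -- Relabel every layer along the zero path of v: a new state z is read as the old
  -- state unrename v z, except that dead (standing for v) rejects or stays dead.
  relabel : ∀ m → Mid (suc d′) (suc m) → Fin (suc d′) → Mid (suc d′) (suc m)
  relabel zero δ v = λ z b → onPath v z false (δ (unrename v z) b)
  relabel (suc m) (δ , rest) v =
    (λ z b → onPath v z dead (rename (δ v false) (δ (unrename v z) b))) ,
    relabel m rest (δ v false)

  relabel-suddenDeath : ∀ m P v → SDMid (suc d′) m (relabel m P v)
  relabel-suddenDeath zero δ v b = onPath-path v dead _ _ (unrename-dead v)
  relabel-suddenDeath (suc m) (δ , rest) v =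
    (λ b → onPath-path v dead _ _ (unrename-dead v)) , relabel-suddenDeath m rest (δ v false)

  relabel-correct : ∀ m P v z xs →
                    runMid m (relabel m P v) z xs ≡ runAvoiding m P (unrename v z) v xs
  relabel-correct zero δ v z (b ∷ []) = by-cases (unrename v z ≟ v)
    where
    by-cases : Dec (unrename v z ≡ v) →
               runMid zero (relabel zero δ v) z (b ∷ []) ≡ runAvoiding zero δ (unrename v z) v (b ∷ [])
    by-cases (yes on-path) = trans (onPath-path v z _ _ on-path)
      (sym (runAvoiding-on-path zero δ (unrename v z) v on-path (b ∷ [])))
    by-cases (no off-path) = trans (onPath-off v z _ _ off-path)
      (sym (runAvoiding-off-path zero δ (unrename v z) v off-path (b ∷ [])))
  relabel-correct (suc m) P@(δ , rest) v z (b ∷ xs) = by-cases (x ≟ v)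
    where
    open ≡-Reasoning
    v₁ x y : Fin (suc d′)
    v₁ = δ v false
    x = unrename v z
    y = δ x b
    next : Fin (suc d′) → Bool
    next u = runMid m (relabel m rest v₁) u xs
    by-cases : Dec (x ≡ v) →
               runMid (suc m) (relabel (suc m) P v) z (b ∷ xs) ≡ runAvoiding (suc m) P x v (b ∷ xs)
    by-cases (yes on-path) = begin
      next (onPath v z dead (rename v₁ y))          ≡⟨ cong next (onPath-path v z _ _ on-path) ⟩
      next dead                                     ≡⟨ relabel-correct m rest v₁ dead xs ⟩
      runAvoiding m rest (unrename v₁ dead) v₁ xs   ≡⟨ on-dead m rest v₁ xs ⟩
      false                                         ≡⟨ runAvoiding-on-path (suc m) P x v on-path (b ∷ xs) ⟨
      runAvoiding (suc m) P x v (b ∷ xs)            ∎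
    by-cases (no off-path) = begin
      next (onPath v z dead (rename v₁ y))          ≡⟨ cong next (onPath-off v z _ _ off-path) ⟩
      next (rename v₁ y)                            ≡⟨ relabel-correct m rest v₁ (rename v₁ y) xs ⟩
      runAvoiding m rest (unrename v₁ (rename v₁ y)) v₁ xs
        ≡⟨ cong (λ u → runAvoiding m rest u v₁ xs) (unrename-rename v₁ y) ⟩
      runAvoiding m rest y v₁ xs                    ≡⟨ runAvoiding-off-path (suc m) P x v off-path (b ∷ xs) ⟨
      runAvoiding (suc m) P x v (b ∷ xs)            ∎

  stepAvoiding-computableSD : ∀ m δ rest x v →
    ComputableSD (suc d′) (suc (suc m)) (stepAvoiding (suc m) (δ , rest) x v)
  stepAvoiding-computableSD m δ rest x v =
    ((λ b → rename v₁ (δ x b)) , relabel m rest v₁) , relabel-suddenDeath m rest v₁ , correct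
    where
    v₁ : Fin (suc d′)
    v₁ = δ v false
    correct : ∀ xs → eval (suc (suc m)) ((λ b → rename v₁ (δ x b)) , relabel m rest v₁) xs
                     ≡ stepAvoiding (suc m) (δ , rest) x v xs
    correct (b ∷ xs) =
      trans (relabel-correct m rest v₁ (rename v₁ (δ x b)) xs)
            (cong (λ u → runAvoiding m rest u v₁ xs) (unrename-rename v₁ (δ x b)))

-- Restrictions of f to a subcube 0^k·{0,1}^m with k + m = n: a sudden-death program g
-- accepting only inputs y with f(0^k·y) = 1, together with a property of (k, m, g).
module Restrictions where

  open import Data.Bool using (Bool; true; false)
  open import Data.Nat using (suc; _+_)
  open import Data.Vec using (Vec; replicate; _++_; _∷_)
  open import Data.Product using (Σ; _×_; _,_)
  open import Relation.Binary.PropositionalEquality using (_≡_; refl; subst)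
  open import Defs using (ComputableSD)

  Property : Set₁
  Property = ℕ → (m : ℕ) → (Vec Bool m → Bool) → Set

  Restriction : ∀ d n → (Vec Bool n → Bool) → Property → Set
  Restriction d n f Good =
    Σ ℕ λ k → Σ ℕ λ m → Σ (k + m ≡ n) λ eq → Σ (Vec Bool m → Bool) λ g →
      ComputableSD d m g
      × ((y : Vec Bool m) → g y ≡ true → f (subst (Vec Bool) eq (replicate k false ++ y)) ≡ true)
      × Good k m g

  Restriction-map : ∀ {d n} {f f′ : Vec Bool n → Bool} {Good Good′ : Property} →
    (∀ x → f x ≡ true → f′ x ≡ true) →
    (∀ {k m} (g : Vec Bool m → Bool) → k + m ≡ n → Good k m g → Good′ k m g) →
    Restriction d n f Good → Restriction d n f′ Good′
  Restriction-map f⊆f′ weaken (k , m , eq , g , sd , g⊆f , good) =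
    k , m , eq , g , sd , (λ y accepted → f⊆f′ _ (g⊆f y accepted)) , weaken g eq good

  prependZero : ∀ {d n} {f : Vec Bool (suc n) → Bool} {Good : Property} →
    Restriction d n (λ x → f (false ∷ x)) (λ k → Good (suc k)) → Restriction d (suc n) f Good
  prependZero (k , m , refl , g , sd , g⊆f , good) = suc k , m , refl , g , sd , g⊆f , good

-- The greedy choice of where along the zero path to prune.
module Greedy (d′ : ℕ) where

  open import Data.Bool using (false)
  open import Data.Nat using (zero; suc; _*_; _^_; _≤_; _≤?_)
  open import Data.Nat.Properties using (≤-reflexive; ≰⇒>; *-identityˡ)
  open import Data.Vec using ([]; _∷_)
  open import Data.Product using (_,_)
  open import Data.Unit using (tt)
  open import Relation.Nullary using (yes; no)
  open import Relation.Binary.PropositionalEquality using (refl; cong; sym; trans; subst)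
  open import Defs using (Mid; runMid; count)
  open Arithmetic using (skip-bound; prune-bound)
  open Pruning {suc d′}
  open SuddenDeathForm d′ using (stepAvoiding-computableSD)
  open Restrictions using (Restriction; Restriction-map; prependZero)

  -- Step along the zero path while peak/(bits left) does not drop; prune where it drops.
  greedy : ∀ m (P : Mid (suc d′) (suc m)) s →
           Restriction (suc d′) (suc m) (runMid m P s)
                       (λ k m′ g → peak m P s ≤ suc m * (2 ^ k * count m′ g))
  greedy zero P s =
    0 , 1 , refl , runMid zero P s , (P s , tt , λ { (b ∷ []) → refl }) ,
    (λ _ accepted → accepted) , ≤-reflexive (sym (trans (*-identityˡ _) (*-identityˡ _)))
  greedy (suc m) P@(δ , rest) s
    with suc m * peak (suc m) P s ≤? suc (suc m) * (2 * peak m rest (δ s false))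
  ... | yes flat =
    prependZero {f = runMid (suc m) P s}
      (Restriction-map {f = runMid m rest (δ s false)} (λ _ accepted → accepted)
        (λ {k} {m′} g _ bound →
           skip-bound m (peak (suc m) P s) (peak m rest (δ s false)) (2 ^ k) (count m′ g) flat bound)
        (greedy m rest (δ s false)))
  ... | no steep =
    0 , suc (suc m) , refl , stepAvoiding (suc m) P s s ,
    stepAvoiding-computableSD m δ rest s s , stepAvoiding-sound (suc m) P s s ,
    subst (peak (suc m) P s ≤_) (cong (suc (suc m) *_) (sym (*-identityˡ kept)))
      (prune-bound (suc m) (accepts (suc m) P s) (2 * peak m rest (δ s false)) kept
                   (≰⇒> steep) (stepAvoiding-loss m δ rest s s))
    where
    kept : ℕ
    kept = count (suc (suc m)) (stepAvoiding (suc m) P s s)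

-- A program of length m+1, viewed as a middle part whose first layer ignores the
-- current state, so that the start state may be any state of width d.
module StartState {d : ℕ} where

  open import Data.Nat using (zero; suc)
  open import Data.Fin using (Fin)
  open import Data.Vec using ([]; _∷_)
  open import Data.Product using (_,_)
  open import Relation.Binary.PropositionalEquality using (_≡_; refl)
  open import Defs using (ROBP; Mid; eval; runMid)

  asMid : ∀ m → ROBP d (suc m) → Mid d (suc m)
  asMid zero δ = λ _ → δ
  asMid (suc m) (δ₀ , rest) = (λ _ → δ₀) , rest

  asMid-correct : ∀ m (P : ROBP d (suc m)) (s : Fin d) x →
                  eval (suc m) P x ≡ runMid m (asMid m P) s x
  asMid-correct zero P s (b ∷ []) = refl
  asMid-correct (suc m) P s (b ∷ xs) = refl

open import Defs
open import Data.Bool using (Bool; true; false)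
open import Data.Nat using (ℕ; _+_; _≤_; NonZero)
open import Data.Vec using (Vec; replicate; _++_)
open import Data.Product using (Σ; _×_)
open import Data.Rational using (_*_) renaming (_≤_ to _≤ℚ_)
open import Relation.Binary.PropositionalEquality using (_≡_; subst)

import Data.Nat as ℕ
open import Data.Nat using (suc; s≤s)
open import Data.Nat.Properties using (≤-trans; ≤-reflexive)
open import Data.Fin using (zero)
open import Data.Product using (_,_)
open import Relation.Binary.PropositionalEquality using (sym; trans)
open Counting using (count-ext; count≤2^n)
open Fractions using (density-bound)
open Pruning using (peak; accepts≤peak)
open Restrictions using (Restriction-map)
open StartState using (asMid; asMid-correct)

theorem6p5 : (d n : ℕ) → 2 ≤ d → .{{_ : NonZero n}} →
    (f : Vec Bool n → Bool) → Computable d n f →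
    Σ ℕ λ k → Σ ℕ λ m → Σ (k + m ≡ n) λ eq →
      Σ (Vec Bool m → Bool) λ g →
        ComputableSD d m g
        × ((y : Vec Bool m) → g y ≡ true →
             f (subst (Vec Bool) eq (replicate k false ++ y)) ≡ true)
        × ((E n f * E n f) * inv2n n ≤ℚ E m g)
theorem6p5 (suc d′) (suc n′) (s≤s _) f (P , computes) =
  Restriction-map run⊆f estimate (Greedy.greedy d′ n′ start zero)
  where
  start : Mid (suc d′) (suc n′)
  start = asMid n′ P
  f≡run : ∀ x → f x ≡ runMid n′ start zero x
  f≡run x = trans (sym (computes x)) (asMid-correct n′ P zero x)
  run⊆f : ∀ x → runMid n′ start zero x ≡ true → f x ≡ true
  run⊆f x accepted = trans (f≡run x) accepted
  count≤peak : count (suc n′) f ≤ peak n′ start zero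
  count≤peak = ≤-trans (≤-reflexive (count-ext (suc n′) f≡run)) (accepts≤peak n′ start zero)
  estimate : ∀ {k m} (g : Vec Bool m → Bool) → k + m ≡ suc n′ →
             peak n′ start zero ≤ suc n′ ℕ.* (2 ℕ.^ k ℕ.* count m g) →
             (E (suc n′) f * E (suc n′) f) * inv2n (suc n′) ≤ℚ E m g
  estimate {k} {m} g eq bound =
    density-bound (suc n′) k m (count (suc n′) f) (count m g) eq
                  (count≤2^n (suc n′) f) (≤-trans count≤peak bound)
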